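{- Let $p$ be a prime, $k\in\mathbb{N}$ and $n\in\mathbb{Z}^+$. Then $$\frac{\rho_p((p^k-1)n)}{p-1}=\sum_{j=1}^{\infty}\left\{\frac{(p^k-1)n}{p^j}\right\}\geqslant k,$$ and hence the expansion of $(p^k-1)n$ in base $p$ has at least $k$ nonzero digits.
   Context: For $a\in\mathbb{N}$, $\rho_p(a)$ denotes the sum of the digits of $a$ in base $p$. For a real number $y$, $\{y\}=y-\lfloor y\rfloor$ is its fractional part. -}

module Defs where

open import Data.Nat using (ℕ; zero; suc; _+_; _*_; _∸_; _^_; _≤_; _≟_)
open import Data.Nat.DivMod using (_/_; _%_)
open import Data.Integer using (+_)
open import Data.Rational using (ℚ; 0ℚ; floor; ∣_∣; _<_) renaming (_/_ to _/ℚ_; _+_ to _+ℚ_; _-_ to _-ℚ_)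
open import Data.List using (List; []; _∷_; length; filter)
open import Data.Nat.ListAction using (sum)
open import Data.Product using (∃-syntax)
open import Relation.Nullary.Decidable using (¬?)

-- a / b as a rational number (for b = 0 this is a junk value 0; it is only
-- used with b ≠ 0)
_÷ℚ_ : ℕ → ℕ → ℚ
a ÷ℚ zero    = 0ℚ
a ÷ℚ suc b   = (+ a) /ℚ suc b

frac : ℚ → ℚ
frac y = y -ℚ ((floor y) /ℚ 1)

-- base-b digits of m, least significant first (meaningful for b ≥ 2);
-- fuel m suffices since m / b < m for m > 0, b ≥ 2.
digitsAux : ℕ → ℕ → ℕ → List ℕ
digitsAux b zero    m       = []
digitsAux b (suc f) zero    = []
digitsAux zero (suc f) (suc m) = []
digitsAux (suc b) (suc f) (suc m) =
  (suc m % suc b) ∷ digitsAux (suc b) f (suc m / suc b)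

digits : ℕ → ℕ → List ℕ
digits b m = digitsAux b m m

ρ : ℕ → ℕ → ℕ
ρ b m = sum (digits b m)

nonzeroDigits : ℕ → ℕ → ℕ
nonzeroDigits b m = length (filter (λ d → ¬? (d ≟ 0)) (digits b m))

partialSum : (ℕ → ℚ) → ℕ → ℚ
partialSum f zero    = 0ℚ
partialSum f (suc J) = partialSum f J +ℚ f (suc J)

HasSum : (ℕ → ℚ) → ℚ → Set
HasSum f L = ∀ (ε : ℚ) → 0ℚ < ε → ∃[ N ] (∀ J → N ≤ J → ∣ L -ℚ partialSum f J ∣ < ε)

module Submission where

-- The proof combines three facts.
-- * Legendre's formula (p - 1)·Σ_{j≤J} ⌊m/pʲ⌋ + ρₚ(m) = m for m < pᴶ.  Read over ℚ it
--   makes the partial sums of Σ {m/pʲ} telescope: once m < pᴶ the J-th remainder is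
--   exactly m/((p - 1)pᴶ), so the series sums to ρₚ(m)/(p - 1) (module Series).
-- * Casting out pᵏ - 1: a multiple x ≥ pᵏ of pᵏ - 1, x = r + q·pᵏ with r < pᵏ, may be
--   replaced by the smaller multiple r + q without increasing the digit sum (digit sums
--   are additive over blocks, and subadditive — again by Legendre's formula).  The descent
--   ends at pᵏ - 1, of digit sum k(p - 1); hence ρₚ(m) ≥ k(p - 1).
-- * Each digit is at most p - 1, so ρₚ(m) ≤ (p - 1)·(number of nonzero digits).

open import Defs
open import Data.Nat
open import Data.Nat.Properties
open import Data.Nat.DivMod
open import Data.Nat.Primality using (Prime; ¬prime[0]; ¬prime[1])
open import Data.Nat.Divisibility using (_∣_; divides; ∣m+n∣m⇒∣n; n∣m*n; ∣⇒≤)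
open import Data.Nat.Induction using (<-wellFounded)
open import Data.Nat.Tactic.RingSolver using (solve-∀)
open import Data.List using (List; []; _∷_; length; filter)
open import Data.List.Relation.Unary.All using (All; []; _∷_)
open import Data.Nat.ListAction using (sum)
open import Algebra.Properties.CommutativeSemigroup +-commutativeSemigroup using (interchange)
open import Data.Empty using (⊥-elim)
open import Data.Product using (_×_; _,_; Σ-syntax)
open import Induction.WellFounded using (Acc; acc)
open import Relation.Binary.PropositionalEquality
  using (_≡_; refl; sym; trans; cong; cong₂; subst; subst₂; module ≡-Reasoning)
open import Relation.Nullary.Decidable using (yes; no; ¬?)

import Data.Integer as ℤ using (_+_; _*_; _≤_; _<_; +≤+; +<+)
import Data.Integer.Properties as ℤ
open import Data.Rational as ℚ using (ℚ; mkℚ; floor; toℚᵘ; ↥_; ↧_) renaming (_≤_ to _≤ℚ_)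
import Data.Rational.Properties as ℚ
open import Data.Rational.Unnormalised as ℚᵘ using (mkℚᵘ; *≡*; *≤*; *<*)
import Data.Rational.Unnormalised.Properties as ℚᵘ
open import Data.Rational.Solver using (module +-*-Solver)

/-superadditive : ∀ a c d .{{_ : NonZero d}} → a / d + c / d ≤ (a + c) / d
/-superadditive a c d = begin
  a / d + c / d             ≡⟨ m*n/n≡m (a / d + c / d) d ⟨
  (a / d + c / d) * d / d   ≤⟨ /-monoˡ-≤ d (begin
      (a / d + c / d) * d       ≡⟨ *-distribʳ-+ d (a / d) (c / d) ⟩
      a / d * d + c / d * d     ≤⟨ +-mono-≤ (m/n*n≤m a d) (m/n*n≤m c d) ⟩
      a + c                     ∎) ⟩
  (a + c) / d               ∎
  where open ≤-Reasoning

-- Base-p digit sums, for the base p = b + 2 (written so that digitsAux computes).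
module Base (b : ℕ) where

  p : ℕ
  p = suc (suc b)

  1<p : 1 < p
  1<p = s≤s (s≤s z≤n)

  n<p^n : ∀ n → n < p ^ n
  n<p^n zero    = s≤s z≤n
  n<p^n (suc n) = ≤-<-trans (n<p^n n) (^-monoʳ-< p 1<p (n<1+n n))

  1+m/p≤m : ∀ m → suc m / p ≤ m
  1+m/p≤m m = ≤-pred (m/n<m (suc m) p 1<p)

  digitsAux-fuel : ∀ f g m → m ≤ f → m ≤ g → digitsAux p f m ≡ digitsAux p g m
  digitsAux-fuel zero    zero    zero _ _ = refl
  digitsAux-fuel zero    (suc g) zero _ _ = refl
  digitsAux-fuel (suc f) zero    zero _ _ = refl
  digitsAux-fuel (suc f) (suc g) zero _ _ = refl
  digitsAux-fuel (suc f) (suc g) (suc m) (s≤s m≤f) (s≤s m≤g) =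
    cong (suc m % p ∷_) (digitsAux-fuel f g (suc m / p) (≤-trans (1+m/p≤m m) m≤f) (≤-trans (1+m/p≤m m) m≤g))

  ρ-rec : ∀ x → ρ p x ≡ x % p + ρ p (x / p)
  ρ-rec zero    = refl
  ρ-rec (suc m) = cong (λ ds → suc m % p + sum ds)
    (digitsAux-fuel m (suc m / p) (suc m / p) (1+m/p≤m m) ≤-refl)

  ρ-step : ∀ r q → r < p → ρ p (r + q * p) ≡ r + ρ p q
  ρ-step r q r<p = begin
    ρ p (r + q * p)                            ≡⟨ ρ-rec (r + q * p) ⟩
    (r + q * p) % p + ρ p ((r + q * p) / p)    ≡⟨ cong₂ (λ d x → d + ρ p x) low high ⟩
    r + ρ p q                                  ∎
    where
      open ≡-Reasoning
      low : (r + q * p) % p ≡ r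
      low = trans ([m+kn]%n≡m%n r q p) (m<n⇒m%n≡m r<p)
      high : (r + q * p) / p ≡ q
      high = begin
        (r + q * p) / p      ≡⟨ +-distrib-/-∣ʳ r (divides q refl) ⟩
        r / p + q * p / p    ≡⟨ cong₂ _+_ (m<n⇒m/n≡0 r<p) (m*n/n≡m q p) ⟩
        q                    ∎

  ρ-block : ∀ k a c → a < p ^ k → ρ p (a + c * p ^ k) ≡ ρ p a + ρ p c
  ρ-block zero    zero    c _         = cong (ρ p) (*-identityʳ c)
  ρ-block zero    (suc a) c (s≤s ())
  ρ-block (suc k) a       c a<p^[1+k] = begin
    ρ p (a + c * p ^ suc k)                  ≡⟨ cong (ρ p) regroup ⟩
    ρ p (a % p + (a / p + c * p ^ k) * p)    ≡⟨ ρ-step (a % p) (a / p + c * p ^ k) (m%n<n a p) ⟩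
    a % p + ρ p (a / p + c * p ^ k)          ≡⟨ cong (a % p +_) (ρ-block k (a / p) c a/p<p^k) ⟩
    a % p + (ρ p (a / p) + ρ p c)            ≡⟨ +-assoc (a % p) _ _ ⟨
    a % p + ρ p (a / p) + ρ p c              ≡⟨ cong (_+ ρ p c) (ρ-rec a) ⟨
    ρ p a + ρ p c                            ∎
    where
      open ≡-Reasoning
      a/p<p^k : a / p < p ^ k
      a/p<p^k = m<n*o⇒m/o<n (subst (a <_) (*-comm p (p ^ k)) a<p^[1+k])
      shape : ∀ r s c P Q → r + s * P + c * (P * Q) ≡ r + (s + c * Q) * P
      shape = solve-∀
      regroup : a + c * p ^ suc k ≡ a % p + (a / p + c * p ^ k) * p
      regroup = trans (cong (_+ c * p ^ suc k) (m≡m%n+[m/n]*n a p)) (shape (a % p) (a / p) c p (p ^ k))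

  -- pᵏ - 1 is written with k digits p - 1.
  ρ-p^k-1 : ∀ k → ρ p (p ^ k ∸ 1) ≡ k * suc b
  ρ-p^k-1 zero    = refl
  ρ-p^k-1 (suc k) = begin
    ρ p (p ^ suc k ∸ 1)           ≡⟨ cong (λ x → ρ p (x ∸ 1)) p^[1+k] ⟩
    ρ p (suc b + (p ^ k ∸ 1) * p) ≡⟨ ρ-step (suc b) (p ^ k ∸ 1) ≤-refl ⟩
    suc b + ρ p (p ^ k ∸ 1)       ≡⟨ cong (suc b +_) (ρ-p^k-1 k) ⟩
    suc k * suc b                 ∎
    where
      open ≡-Reasoning
      p^[1+k] : p ^ suc k ≡ p + (p ^ k ∸ 1) * p
      p^[1+k] = trans (cong (p *_) (sym (m+[n∸m]≡n (m^n>0 p k)))) (*-comm p (suc (p ^ k ∸ 1)))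

  floorSum : ℕ → ℕ → ℕ
  floorSum m zero    = 0
  floorSum m (suc J) = floorSum m J + (m / p ^ suc J) {{m^n≢0 p (suc J)}}

  -- Using ⌊⌊m/p⌋/pʲ⌋ = ⌊m/pʲ⁺¹⌋, the sum for m is ⌊m/p⌋ plus the sum for ⌊m/p⌋.
  floorSum-shift : ∀ m J → floorSum m (suc J) ≡ m / p + floorSum (m / p) J
  floorSum-shift m zero    = trans (/-congʳ {m = m} {{m^n≢0 p 1}} (*-identityʳ p)) (sym (+-identityʳ (m / p)))
  floorSum-shift m (suc J) = begin
    floorSum m (suc J) + (m / p ^ suc (suc J)) {{m^n≢0 p (suc (suc J))}}
      ≡⟨ cong₂ _+_ (floorSum-shift m J) (sym (m/n/o≡m/[n*o] m p (p ^ suc J) {{_}} {{m^n≢0 p (suc J)}} {{m^n≢0 p (suc (suc J))}})) ⟩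
    m / p + floorSum (m / p) J + (m / p / p ^ suc J) {{m^n≢0 p (suc J)}}
      ≡⟨ +-assoc (m / p) _ _ ⟩
    m / p + floorSum (m / p) (suc J) ∎
    where open ≡-Reasoning

  legendre : ∀ J m → m < p ^ J → suc b * floorSum m J + ρ p m ≡ m
  legendre zero    zero    _         = cong (_+ 0) (*-zeroʳ b)
  legendre zero    (suc m) (s≤s ())
  legendre (suc J) m       m<p^[1+J] = begin
    suc b * floorSum m (suc J) + ρ p m
      ≡⟨ cong₂ (λ s r → suc b * s + r) (floorSum-shift m J) (ρ-rec m) ⟩
    suc b * (q + floorSum q J) + (m % p + ρ p q)
      ≡⟨ regroup b q (floorSum q J) (m % p) (ρ p q) ⟩
    m % p + suc b * q + (suc b * floorSum q J + ρ p q)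
      ≡⟨ cong (m % p + suc b * q +_) (legendre J q q<p^J) ⟩
    m % p + suc b * q + q
      ≡⟨ digit b (m % p) q ⟩
    m % p + q * p
      ≡⟨ m≡m%n+[m/n]*n m p ⟨
    m ∎
    where
      open ≡-Reasoning
      q = m / p
      q<p^J : q < p ^ J
      q<p^J = m<n*o⇒m/o<n (subst (m <_) (*-comm p (p ^ J)) m<p^[1+J])
      regroup : ∀ b x g r y → suc b * (x + g) + (r + y) ≡ r + suc b * x + (suc b * g + y)
      regroup = solve-∀
      digit : ∀ b r x → r + suc b * x + x ≡ r + x * suc (suc b)
      digit = solve-∀

  floorSum-superadditive : ∀ a c J → floorSum a J + floorSum c J ≤ floorSum (a + c) J
  floorSum-superadditive a c zero    = z≤n
  floorSum-superadditive a c (suc J) = begin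
    floorSum a J + a / P + (floorSum c J + c / P)  ≡⟨ interchange (floorSum a J) (a / P) (floorSum c J) (c / P) ⟩
    floorSum a J + floorSum c J + (a / P + c / P)  ≤⟨ +-mono-≤ (floorSum-superadditive a c J) (/-superadditive a c P) ⟩
    floorSum (a + c) J + (a + c) / P               ∎
    where
      open ≤-Reasoning
      P = p ^ suc J
      instance
        _ : NonZero P
        _ = m^n≢0 p (suc J)

  -- The digit sum is subadditive: ρₚ(a + c) ≤ ρₚ(a) + ρₚ(c).  By Legendre's
  -- formula this is the superadditivity of the floor sums (no carries are lost).
  ρ-subadditive : ∀ a c → ρ p (a + c) ≤ ρ p a + ρ p c
  ρ-subadditive a c = +-cancelˡ-≤ (suc b * (floorSum a J + floorSum c J)) _ _ (begin
    suc b * (floorSum a J + floorSum c J) + ρ p (a + c)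
      ≤⟨ +-monoˡ-≤ (ρ p (a + c)) (*-monoʳ-≤ (suc b) (floorSum-superadditive a c J)) ⟩
    suc b * floorSum (a + c) J + ρ p (a + c)
      ≡⟨ legendre J (a + c) (n<p^n J) ⟩
    a + c
      ≡⟨ cong₂ _+_ (legendre J a (≤-<-trans (m≤m+n a c) (n<p^n J))) (legendre J c (≤-<-trans (m≤n+m c a) (n<p^n J))) ⟨
    (suc b * floorSum a J + ρ p a) + (suc b * floorSum c J + ρ p c)
      ≡⟨ collect (suc b) (floorSum a J) (floorSum c J) (ρ p a) (ρ p c) ⟩
    suc b * (floorSum a J + floorSum c J) + (ρ p a + ρ p c) ∎)
    where
      open ≤-Reasoning
      J = a + c
      collect : ∀ d x y u v → (d * x + u) + (d * y + v) ≡ d * (x + y) + (u + v)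
      collect = solve-∀

  -- Casting out pᵏ - 1 (for k ≥ 1): every positive multiple x of pᵏ - 1 has
  -- digit sum at least ρₚ(pᵏ - 1) = k(p - 1).  If x ≥ pᵏ, write x = r + q·pᵏ
  -- with r < pᵏ; then y = r + q is a smaller positive multiple of pᵏ - 1
  -- (x = y + q·(pᵏ - 1)) and ρₚ(y) ≤ ρₚ(r) + ρₚ(q) = ρₚ(x).  Otherwise x = pᵏ - 1.
  module CastingOut (k : ℕ) where

    K M : ℕ
    K = p ^ suc k
    M = K ∸ 1

    instance
      K≢0 : NonZero K
      K≢0 = m^n≢0 p (suc k)

    K≡1+M : K ≡ suc M
    K≡1+M = sym (m+[n∸m]≡n (m^n>0 p (suc k)))

    1≤M : 1 ≤ M
    1≤M = ≤-pred (subst (1 <_) K≡1+M (^-monoʳ-< p 1<p {0} {suc k} z<s))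

    fold : ℕ → ℕ
    fold x = x % K + x / K

    fold-≡ : ∀ x → x ≡ x / K * M + fold x
    fold-≡ x = begin
      x                          ≡⟨ m≡m%n+[m/n]*n x K ⟩
      x % K + x / K * K          ≡⟨ cong (λ L → x % K + x / K * L) K≡1+M ⟩
      x % K + x / K * suc M      ≡⟨ shape (x % K) (x / K) M ⟩
      x / K * M + fold x         ∎
      where
        open ≡-Reasoning
        shape : ∀ r q M → r + q * suc M ≡ q * M + (r + q)
        shape = solve-∀

    fold-∣ : ∀ x → M ∣ x → M ∣ fold x
    fold-∣ x M∣x = ∣m+n∣m⇒∣n (subst (M ∣_) (fold-≡ x) M∣x) (n∣m*n (x / K))

    fold-positive : ∀ x → K ≤ x → 0 < fold x
    fold-positive x K≤x = ≤-trans (m≥n⇒m/n>0 K≤x) (m≤n+m (x / K) (x % K))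

    fold-< : ∀ x → K ≤ x → fold x < x
    fold-< x K≤x = begin-strict
      fold x                  <⟨ m<n+m (fold x) (*-mono-≤ (m≥n⇒m/n>0 K≤x) 1≤M) ⟩
      x / K * M + fold x      ≡⟨ fold-≡ x ⟨
      x                       ∎
      where open ≤-Reasoning

    fold-ρ : ∀ x → ρ p (fold x) ≤ ρ p x
    fold-ρ x = begin
      ρ p (x % K + x / K)         ≤⟨ ρ-subadditive (x % K) (x / K) ⟩
      ρ p (x % K) + ρ p (x / K)   ≡⟨ ρ-block (suc k) (x % K) (x / K) (m%n<n x K) ⟨
      ρ p (x % K + x / K * K)     ≡⟨ cong (ρ p) (m≡m%n+[m/n]*n x K) ⟨
      ρ p x                       ∎
      where open ≤-Reasoning

    ρ-multiple : ∀ x → Acc _<_ x → 0 < x → M ∣ x → suc k * suc b ≤ ρ p x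
    ρ-multiple x (acc smaller) 0<x M∣x with x <? K
    ... | yes x<K = ≤-reflexive (trans (sym (ρ-p^k-1 (suc k))) (cong (ρ p) M≡x))
      where
        M≡x : M ≡ x
        M≡x = ≤-antisym (∣⇒≤ {{>-nonZero 0<x}} M∣x) (≤-pred (subst (x <_) K≡1+M x<K))
    ... | no  x≮K = ≤-trans
      (ρ-multiple (fold x) (smaller (fold-< x K≤x)) (fold-positive x K≤x) (fold-∣ x M∣x))
      (fold-ρ x)
      where
        K≤x : K ≤ x
        K≤x = ≮⇒≥ x≮K

  ρ-multiple-of-p^k-1 : ∀ k n → 0 < n → k * suc b ≤ ρ p ((p ^ k ∸ 1) * n)
  ρ-multiple-of-p^k-1 zero    n _   = z≤n
  ρ-multiple-of-p^k-1 (suc k) n 0<n = ρ-multiple (M * n) (<-wellFounded _) (*-mono-≤ 1≤M 0<n) (divides n (*-comm M n))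
    where open CastingOut k

  digits<p : ∀ f m → All (_< p) (digitsAux p f m)
  digits<p zero    m       = []
  digits<p (suc f) zero    = []
  digits<p (suc f) (suc m) = m%n<n (suc m) p ∷ digits<p f (suc m / p)

  countNonzero : List ℕ → ℕ
  countNonzero ds = length (filter (λ x → ¬? (x ≟ 0)) ds)

  sum≤countNonzero : ∀ ds → All (_< p) ds → sum ds ≤ countNonzero ds * suc b
  sum≤countNonzero []           []           = z≤n
  sum≤countNonzero (zero  ∷ ds) (_   ∷ ds<p) = sum≤countNonzero ds ds<p
  sum≤countNonzero (suc x ∷ ds) (x<p ∷ ds<p) = +-mono-≤ (≤-pred x<p) (sum≤countNonzero ds ds<p)

  ρ≤nonzeroDigits : ∀ m → ρ p m ≤ nonzeroDigits p m * suc b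
  ρ≤nonzeroDigits m = sum≤countNonzero (digits p m) (digits<p m m)

module Fractions where

  -- opened only here: at top level +_ would clash with sections of ℕ's _+_
  open import Data.Integer using (+_; -[1+_]; +[1+_])

  ÷ℚ-toℚᵘ : ∀ a d → toℚᵘ (a ÷ℚ suc d) ℚᵘ.≃ mkℚᵘ (+ a) d
  ÷ℚ-toℚᵘ a d = ℚ.toℚᵘ-fromℚᵘ (mkℚᵘ (+ a) d)

  ÷ℚ-cong : ∀ a c d e .{{_ : NonZero d}} .{{_ : NonZero e}} → a * e ≡ c * d → a ÷ℚ d ≡ c ÷ℚ e
  ÷ℚ-cong a c (suc d) (suc e) eq = ℚ.fromℚᵘ-cong {mkℚᵘ (+ a) d} {mkℚᵘ (+ c) e} (*≡* (begin
    + a ℤ.* + suc e    ≡⟨ ℤ.pos-* a (suc e) ⟨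
    + (a * suc e)      ≡⟨ cong +_ eq ⟩
    + (c * suc d)      ≡⟨ ℤ.pos-* c (suc d) ⟩
    + c ℤ.* + suc d    ∎))
    where open ≡-Reasoning

  ÷ℚ-+ : ∀ a c d e .{{_ : NonZero d}} .{{_ : NonZero e}} →
         (a ÷ℚ d) ℚ.+ (c ÷ℚ e) ≡ (a * e + c * d) ÷ℚ (d * e)
  ÷ℚ-+ a c (suc d) (suc e) = ℚ.toℚᵘ-injective (begin
    toℚᵘ (a ÷ℚ suc d ℚ.+ c ÷ℚ suc e)           ≈⟨ ℚ.toℚᵘ-homo-+ (a ÷ℚ suc d) (c ÷ℚ suc e) ⟩
    toℚᵘ (a ÷ℚ suc d) ℚᵘ.+ toℚᵘ (c ÷ℚ suc e)   ≈⟨ ℚᵘ.+-cong (÷ℚ-toℚᵘ a d) (÷ℚ-toℚᵘ c e) ⟩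
    mkℚᵘ (+ a) d ℚᵘ.+ mkℚᵘ (+ c) e             ≈⟨ *≡* (cong (ℤ._* + (suc d * suc e)) numerator) ⟩
    mkℚᵘ (+ (a * suc e + c * suc d)) _         ≈⟨ ÷ℚ-toℚᵘ _ _ ⟨
    toℚᵘ ((a * suc e + c * suc d) ÷ℚ (suc d * suc e)) ∎)
    where
      open ℚᵘ.≃-Reasoning
      numerator : + a ℤ.* + suc e ℤ.+ + c ℤ.* + suc d ≡ + (a * suc e + c * suc d)
      numerator = trans (cong₂ ℤ._+_ (sym (ℤ.pos-* a (suc e))) (sym (ℤ.pos-* c (suc d))))
                        (sym (ℤ.pos-+ (a * suc e) (c * suc d)))

  ÷ℚ-≤ : ∀ a c d e .{{_ : NonZero d}} .{{_ : NonZero e}} → a * e ≤ c * d → a ÷ℚ d ℚ.≤ c ÷ℚ e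
  ÷ℚ-≤ a c (suc d) (suc e) le = ℚ.toℚᵘ-cancel-≤
    (ℚᵘ.≤-respʳ-≃ (ℚᵘ.≃-sym (÷ℚ-toℚᵘ c e)) (ℚᵘ.≤-respˡ-≃ (ℚᵘ.≃-sym (÷ℚ-toℚᵘ a d))
      (*≤* (subst₂ ℤ._≤_ (ℤ.pos-* a (suc e)) (ℤ.pos-* c (suc d)) (ℤ.+≤+ le)))))

  ÷ℚ-< : ∀ a c d e .{{_ : NonZero d}} .{{_ : NonZero e}} → a * e < c * d → a ÷ℚ d ℚ.< c ÷ℚ e
  ÷ℚ-< a c (suc d) (suc e) lt = ℚ.toℚᵘ-cancel-<
    (ℚᵘ.<-respʳ-≃ (ℚᵘ.≃-sym (÷ℚ-toℚᵘ c e)) (ℚᵘ.<-respˡ-≃ (ℚᵘ.≃-sym (÷ℚ-toℚᵘ a d))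
      (*<* (subst₂ ℤ._<_ (ℤ.pos-* a (suc e)) (ℤ.pos-* c (suc d)) (ℤ.+<+ lt)))))

  ∣÷ℚ∣ : ∀ a d .{{_ : NonZero d}} → ℚ.∣ a ÷ℚ d ∣ ≡ a ÷ℚ d
  ∣÷ℚ∣ a d = ℚ.0≤p⇒∣p∣≡p (÷ℚ-≤ 0 a 1 d z≤n)

  -- ⌊a/d⌋ is natural-number division.  The normal form of a/d is
  -- (a/g)/(d/g) with g = gcd(a, d), and (a/g) div (d/g) = a div d.
  floor-÷ℚ : ∀ a d .{{_ : NonZero d}} → floor (a ÷ℚ d) ≡ + (a / d)
  floor-÷ℚ a (suc d) = reduced (a ÷ℚ suc d) (ℚ.↥-normalize a (suc d)) (ℚ.↧-normalize a (suc d))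
    where
      reduced : ∀ q {g} → ↥ q ℤ.* + g ≡ + a → ↧ q ℤ.* + g ≡ + suc d → floor q ≡ + (a / suc d)
      reduced (mkℚ n d′ _) {zero} _ den with () ← trans (sym (ℤ.*-zeroʳ (+ suc d′))) den
      reduced (mkℚ (+ n) d′ c) {suc g} num den = begin
        floor (mkℚ (+ n) d′ c)               ≡⟨ ℤ.*-identityˡ _ ⟩
        + (n / suc d′)                       ≡⟨ cong +_ (m*n/o*n≡m/o n (suc g) (suc d′)) ⟨
        + (n * suc g / (suc d′ * suc g))     ≡⟨ cong +_ (trans (/-congˡ {o = suc d′ * suc g} n*g≡a) (/-congʳ {m = a} d′*g≡d)) ⟩
        + (a / suc d)                        ∎
        where
          open ≡-Reasoning
          n*g≡a : n * suc g ≡ a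
          n*g≡a = ℤ.+-injective (trans (ℤ.pos-* n (suc g)) num)
          d′*g≡d : suc d′ * suc g ≡ suc d
          d′*g≡d = ℤ.+-injective (trans (ℤ.pos-* (suc d′) (suc g)) den)
      reduced (mkℚ -[1+ n ] d′ _) {suc g} ()

  positive-÷ℚ : ∀ ε → ℚ.0ℚ ℚ.< ε → Σ[ n ∈ ℕ ] Σ[ d ∈ ℕ ] ε ≡ suc n ÷ℚ suc d
  positive-÷ℚ ε@(mkℚ +[1+ n ] d _) _ = n , d , sym (ℚ.↥p/↧p≡p ε)
  positive-÷ℚ (mkℚ (+ zero) d _) (ℚ.*<* (ℤ.+<+ ()))
  positive-÷ℚ (mkℚ -[1+ n ] d _) (ℚ.*<* ())

  frac-÷ℚ : ∀ a d .{{_ : NonZero d}} → frac (a ÷ℚ d) ≡ (a ÷ℚ d) ℚ.- ((a / d) ÷ℚ 1)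
  frac-÷ℚ a d = cong (λ z → (a ÷ℚ d) ℚ.- (z ℚ./ 1)) (floor-÷ℚ a d)

module Series (b m : ℕ) where

  open Base b
  open Fractions

  c : ℕ
  c = suc b

  term : ℕ → ℚ
  term j = frac (m ÷ℚ (p ^ j))

  -- m/((p - 1)pᴶ) = Σ_{j>J} m/pʲ, the tail of the series without floors
  tail : ℕ → ℚ
  tail J = m ÷ℚ (c * p ^ J)

  floors : ℕ → ℚ
  floors J = floorSum m J ÷ℚ 1

  tail-step : ∀ J → tail J ≡ (m ÷ℚ (p ^ suc J)) ℚ.+ tail (suc J)
  tail-step J = trans
    (÷ℚ-cong m _ (c * P) (p * P * (c * (p * P))) (cross b m P))
    (sym (÷ℚ-+ m m (p * P) (c * (p * P))))
    where
      P = p ^ J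
      instance
        _ : NonZero P
        _ = m^n≢0 p J
        _ : NonZero (p * P)
        _ = m^n≢0 p (suc J)
        _ : NonZero (c * P)
        _ = m*n≢0 c P
        _ : NonZero (c * (p * P))
        _ = m*n≢0 c (p * P)
        _ : NonZero (p * P * (c * (p * P)))
        _ = m*n≢0 (p * P) (c * (p * P))
      cross : ∀ b m X → m * (suc (suc b) * X * (suc b * (suc (suc b) * X)))
                        ≡ (m * (suc b * (suc (suc b) * X)) + m * (suc (suc b) * X)) * (suc b * X)
      cross = solve-∀

  floors-step : ∀ J → floors (suc J) ≡ floors J ℚ.+ ((m / p ^ suc J) {{m^n≢0 p (suc J)}} ÷ℚ 1)
  floors-step J = trans (÷ℚ-cong (s + q) (s * 1 + q * 1) 1 1 (unit s q)) (sym (÷ℚ-+ s q 1 1))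
    where
      s = floorSum m J
      q = (m / p ^ suc J) {{m^n≢0 p (suc J)}}
      unit : ∀ x y → (x + y) * 1 ≡ (x * 1 + y * 1) * 1
      unit = solve-∀

  telescope : ∀ J → partialSum term J ℚ.+ tail J ℚ.+ floors J ≡ m ÷ℚ c
  telescope zero    = trans (ℚ.+-identityʳ _) (trans (ℚ.+-identityˡ _)
    (÷ℚ-cong m m (c * 1) c (cong (m *_) (sym (*-identityʳ c)))))
  telescope (suc J) = begin
    partialSum term J ℚ.+ term (suc J) ℚ.+ tail (suc J) ℚ.+ floors (suc J)
      ≡⟨ cong₂ (λ t f → partialSum term J ℚ.+ t ℚ.+ tail (suc J) ℚ.+ f)
               (frac-÷ℚ m (p ^ suc J) {{m^n≢0 p (suc J)}}) (floors-step J) ⟩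
    partialSum term J ℚ.+ (x ℚ.- ⌊x⌋) ℚ.+ tail (suc J) ℚ.+ (floors J ℚ.+ ⌊x⌋)
      ≡⟨ cancel (partialSum term J) x ⌊x⌋ (tail (suc J)) (floors J) ⟩
    partialSum term J ℚ.+ (x ℚ.+ tail (suc J)) ℚ.+ floors J
      ≡⟨ cong (λ t → partialSum term J ℚ.+ t ℚ.+ floors J) (tail-step J) ⟨
    partialSum term J ℚ.+ tail J ℚ.+ floors J
      ≡⟨ telescope J ⟩
    m ÷ℚ c ∎
    where
      open ≡-Reasoning
      open +-*-Solver
      x ⌊x⌋ : ℚ
      x   = m ÷ℚ (p ^ suc J)
      ⌊x⌋ = (m / p ^ suc J) {{m^n≢0 p (suc J)}} ÷ℚ 1
      cancel : ∀ S x y t f → S ℚ.+ (x ℚ.- y) ℚ.+ t ℚ.+ (f ℚ.+ y) ≡ S ℚ.+ (x ℚ.+ t) ℚ.+ f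
      cancel = solve 5 (λ S x y t f → S :+ (x :- y) :+ t :+ (f :+ y) := S :+ (x :+ t) :+ f) refl

  floors-legendre : ∀ J → m < p ^ J → floors J ℚ.+ (ρ p m ÷ℚ c) ≡ m ÷ℚ c
  floors-legendre J m<p^J = trans (÷ℚ-+ (floorSum m J) (ρ p m) 1 c)
    (÷ℚ-cong (floorSum m J * c + ρ p m * 1) m (1 * c) c (trans (rearrange b (floorSum m J) (ρ p m)) (cong (_* (1 * c)) (legendre J m m<p^J))))
    where
      rearrange : ∀ b s r → (s * suc b + r * 1) * suc b ≡ (suc b * s + r) * (1 * suc b)
      rearrange = solve-∀

  remainder : ∀ J → m < p ^ J → (ρ p m ÷ℚ c) ℚ.- partialSum term J ≡ tail J
  remainder J m<p^J = begin
    L ℚ.- S                              ≡⟨ solve 3 (λ L S F → L :- S := (F :+ L) :- F :- S) refl L S F ⟩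
    (F ℚ.+ L) ℚ.- F ℚ.- S                ≡⟨ cong (λ z → z ℚ.- F ℚ.- S) (trans (floors-legendre J m<p^J) (sym (telescope J))) ⟩
    (S ℚ.+ tail J ℚ.+ F) ℚ.- F ℚ.- S     ≡⟨ solve 3 (λ S T F → (S :+ T :+ F) :- F :- S := T) refl S (tail J) F ⟩
    tail J                               ∎
    where
      open ≡-Reasoning
      open +-*-Solver
      L = ρ p m ÷ℚ c
      S = partialSum term J
      F = floors J

  -- Given ε = (1 + n)/(1 + d), every J ≥ m(1 + d) has m(1 + d) < pᴶ, so the
  -- remainder m/((p - 1)pᴶ) is below ε.
  hasSum : HasSum term (ρ p m ÷ℚ c)
  hasSum ε 0<ε with positive-÷ℚ ε 0<ε
  ... | n , d , refl = m * suc d , λ J N≤J → subst (ℚ._< suc n ÷ℚ suc d)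
          (sym (trans (cong ℚ.∣_∣ (remainder J (m<p^J J N≤J))) (∣÷ℚ∣ m (c * p ^ J) {{c*p^J≢0 J}})))
          (÷ℚ-< m (suc n) (c * p ^ J) (suc d) {{c*p^J≢0 J}} (small J N≤J))
    where
      c*p^J≢0 : ∀ J → NonZero (c * p ^ J)
      c*p^J≢0 J = m*n≢0 c (p ^ J) {{_}} {{m^n≢0 p J}}
      big : ∀ J → m * suc d ≤ J → m * suc d < p ^ J
      big J N≤J = <-≤-trans (n<p^n (m * suc d)) (^-monoʳ-≤ p N≤J)
      m<p^J : ∀ J → m * suc d ≤ J → m < p ^ J
      m<p^J J N≤J = ≤-<-trans (m≤m*n m (suc d)) (big J N≤J)
      small : ∀ J → m * suc d ≤ J → m * suc d < suc n * (c * p ^ J)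
      small J N≤J = <-≤-trans (big J N≤J) (≤-trans (m≤n*m (p ^ J) c) (m≤n*m (c * p ^ J) (suc n)))


lemma3p2 : ∀ (p k n : ℕ) → Prime p → 0 < n →
    HasSum (λ j → frac (((p ^ k ∸ 1) * n) ÷ℚ (p ^ j))) (ρ p ((p ^ k ∸ 1) * n) ÷ℚ (p ∸ 1))
    × (k ÷ℚ 1) ≤ℚ (ρ p ((p ^ k ∸ 1) * n) ÷ℚ (p ∸ 1))
    × k ≤ nonzeroDigits p ((p ^ k ∸ 1) * n)
lemma3p2 zero          _ _ 0-prime _   = ⊥-elim (¬prime[0] 0-prime)
lemma3p2 (suc zero)    _ _ 1-prime _   = ⊥-elim (¬prime[1] 1-prime)
lemma3p2 (suc (suc b)) k n _       0<n =
  Series.hasSum b m ,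
  Fractions.÷ℚ-≤ k (ρ p m) 1 (suc b) (subst (k * suc b ≤_) (sym (*-identityʳ (ρ p m))) ρ-bound) ,
  *-cancelʳ-≤ k (nonzeroDigits p m) (suc b) (≤-trans ρ-bound (ρ≤nonzeroDigits m))
  where
    open Base b
    m : ℕ
    m = (p ^ k ∸ 1) * n
    ρ-bound : k * suc b ≤ ρ p m
    ρ-bound = ρ-multiple-of-p^k-1 k n 0<n
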